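{- Let $\mathcal G=(V,V_0,V_1,T,E)$ be a finite game graph (possibly with cycles), $\sigma\in\{0,1\}$, $v\in V$, and consider strategy valuations in $\mathbb S^\infty[T]$ induced by $f_\sigma(t)=t$ for $t\in T$ (with trivial move values). For all strategies $\mathcal S,\mathcal S'\in\mathrm{Strat}_\sigma(v)$: (1) $0\neq F^\nu(\mathcal S)\succeq F^\mu(\mathcal S)\neq1$; (2) $F^\mu(\mathcal S)=0$ if and only if $\mathcal S$ admits an infinite play, and otherwise $F^\mu(\mathcal S)=F^\nu(\mathcal S)$; (3) $F^\nu(\mathcal S)=1$ if and only if $\mathcal S$ admits only infinite plays; (4) $\mathcal S$ absorbs $\mathcal S'$ if and only if both $F^\nu(\mathcal S)\succeq F^\nu(\mathcal S')$ and $F^\mu(\mathcal S)\succeq F^\mu(\mathcal S')$.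
   Context: A game graph is $\mathcal G=(V,V_0,V_1,T,E)$ where $V$ is the disjoint union of $V_0$ (positions of Player 0), $V_1$ (positions of Player 1) and $T$ (terminal positions), $E\subseteq V\times V$, $vE=\{w:(v,w)\in E\}$, $vE=\emptyset$ iff $v\in T$. A strategy of Player $\sigma$ from $v$ is a subtree $\mathcal S$ of the tree unraveling from $v$ (tree of all finite paths from $v$), containing the root, closed under prefixes, keeping exactly one successor at nodes ending in $V_\sigma$ and all successors at nodes ending in $V_{1-\sigma}$; $\mathrm{Plays}(\mathcal S)$ is the set of finite or infinite plays consistent with it; $\#_{\mathcal S}(t)\in\mathbb N^\infty$ is the number of plays of $\mathcal S$ with outcome (final position) $t$. Monomials over $T$ are functions $m:T\to\mathbb N^\infty$ written $\prod t^{m(t)}$; absorption order: $m_1\preceq m_2$ iff $m_1(t)\ge m_2(t)$ for all $t$; extended by $m\succeq0$ for all monomials $m$. $\mathbb S^\infty[T]$ is the semiring of antichains of such monomials (sum: union keeping maximal monomials; product: pairwise products, adding exponents, keeping maximal ones; $0$ the empty antichain; $1$ the monomial with all exponents $0$). For a play $x$: if finite and ending in $t$, $f^\mu_\sigma(x)=f^\nu_\sigma(x)=t$; if infinite, $f^\mu_\sigma(x)=0$ and $f^\nu_\sigma(x)=1$. $F^\mu(\mathcal S):=\prod_{x\in\mathrm{Plays}(\mathcal S)}f^\mu_\sigma(x)$ and $F^\nu(\mathcal S):=\prod_{x\in\mathrm{Plays}(\mathcal S)}f^\nu_\sigma(x)=\prod_{t\in T}t^{\#_{\mathcal S}(t)}$,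 where a possibly infinite product of indeterminates is the monomial whose exponent at $t$ is the number (in $\mathbb N^\infty$) of factors equal to $t$, and a product containing a factor $0$ is $0$. $\mathcal S$ absorbs $\mathcal S'$ if for all $t\in T$, $\mathcal S$ admits at most as many plays with outcome $t$ as $\mathcal S'$, and if $\mathcal S$ admits an infinite play then so does $\mathcal S'$. -}

module Defs where

open import Data.Nat using (ℕ; zero; suc; _≤_)
open import Data.Fin using (Fin)
open import Data.Bool using (Bool; true)
open import Data.List using (List; []; _∷_; length)
open import Data.List.Relation.Unary.All using (All)
open import Data.List.Relation.Unary.Unique.Propositional using (Unique)
open import Data.Product using (Σ; ∃; _×_; _,_; proj₁)
open import Data.Empty using (⊥)
open import Data.Unit using (⊤)
open import Relation.Nullary using (¬_)
open import Relation.Binary.PropositionalEquality using (_≡_)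
open import Function.Bundles using (_⇔_)

data Player : Set where
  P0 P1 : Player

opponent : Player → Player
opponent P0 = P1
opponent P1 = P0

data Kind : Set where
  owned    : Player → Kind
  terminal : Kind

record Game (n : ℕ) : Set where
  field
    kind : Fin n → Kind
    E    : Fin n → Fin n → Bool
    terminal⇔noMove : ∀ v → (kind v ≡ terminal) ⇔ (∀ w → ¬ (E v w ≡ true))

module _ {n : ℕ} (G : Game n) where
  open Game G

  V : Set
  V = Fin n

  Edge : V → V → Set
  Edge u w = E u w ≡ true

  Term : Set
  Term = Σ V (λ t → kind t ≡ terminal)

  -- Nodes of the tree unraveling from v: finite paths from v, stored
  -- REVERSED (last position first, v at the end of the list).
  data IsPath (v : V) : List V → Set where
    root : IsPath v (v ∷ [])
    step : ∀ {u w p} → IsPath v (u ∷ p) → Edge u w → IsPath v (w ∷ u ∷ p)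

  -- Strat_σ(v): subtrees of the unraveling containing the root, closed
  -- under prefixes, keeping exactly one successor at nodes ending in V_σ
  -- and all successors at nodes ending in V_{1-σ}.
  record Strategy (σ : Player) (v : V) : Set₁ where
    field
      node      : List V → Set
      isPath    : ∀ p → node p → IsPath v p
      hasRoot   : node (v ∷ [])
      prefixCl  : ∀ w u p → node (w ∷ u ∷ p) → node (u ∷ p)
      oneSucc   : ∀ u p → node (u ∷ p) → kind u ≡ owned σ →
                  Σ V λ w → node (w ∷ u ∷ p) × (∀ w′ → node (w′ ∷ u ∷ p) → w′ ≡ w)
      allSucc   : ∀ u p → node (u ∷ p) → kind u ≡ owned (opponent σ) →
                  ∀ w → Edge u w → node (w ∷ u ∷ p)

  module _ {σ : Player} {v : V} (S : Strategy σ v) where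
    open Strategy S

    -- a finite play of S with outcome t, given by the reversed path t ∷ q
    PlayTo : Term → List V → Set
    PlayTo t q = node (proj₁ t ∷ q)

    prefixOf : (ℕ → V) → ℕ → List V
    prefixOf π zero    = π zero ∷ []
    prefixOf π (suc k) = π (suc k) ∷ prefixOf π k

    InfPlay : Set
    InfPlay = Σ (ℕ → V) λ π → ∀ k → node (prefixOf π k)

    OnlyInfinite : Set
    OnlyInfinite = ∀ t q → ¬ PlayTo t q

    AtLeast : Term → ℕ → Set
    AtLeast t k = Σ (List (List V)) λ qs →
      length qs ≡ k × Unique qs × All (PlayTo t) qs

data ℕ∞ : Set where
  fin : ℕ → ℕ∞
  ∞   : ℕ∞

data _≤∞_ : ℕ∞ → ℕ∞ → Set where
  fin≤fin : ∀ {m k} → m ≤ k → fin m ≤∞ fin k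
  _≤∞∞    : ∀ x → x ≤∞ ∞

module _ {n : ℕ} (G : Game n) where

  -- #_S(t) = c   (cardinality in ℕ^∞ of the set of plays of S with outcome t)
  Count : ∀ {σ v} → Strategy G σ v → Term G → ℕ∞ → Set
  Count S t (fin k) = AtLeast G S t k × ¬ AtLeast G S t (suc k)
  Count S t ∞       = ∀ k → AtLeast G S t k

  Absorbs : ∀ {σ v} → Strategy G σ v → Strategy G σ v → Set
  Absorbs S S′ =
    (∀ t c c′ → Count S t c → Count S′ t c′ → c ≤∞ c′) ×
    (InfPlay G S → InfPlay G S′)

  Mono : Set
  Mono = Term G → ℕ∞

  _⪯m_ : Mono → Mono → Set
  m₁ ⪯m m₂ = ∀ t → m₂ t ≤∞ m₁ t

  -- elements of S^∞[T]: (antichains of) monomials, given as sets of monomials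
  SInf : Set₁
  SInf = Mono → Set

  0S : SInf
  0S _ = ⊥

  1S : SInf
  1S m = ∀ t → m t ≡ fin 0

  _≈S_ : SInf → SInf → Set
  A ≈S B = ∀ m → A m ⇔ B m

  _⪯S_ : SInf → SInf → Set
  A ⪯S B = ∀ m → A m → Σ Mono λ m′ → B m′ × (m ⪯m m′)

  -- strategy valuations  F^ν(S) = ∏_t t^{#_S(t)},
  -- F^μ(S) = 0 if S admits an infinite play, else ∏_t t^{#_S(t)}

  Fν : ∀ {σ v} → Strategy G σ v → SInf
  Fν S m = ∀ t → Count S t (m t)

  Fμ : ∀ {σ v} → Strategy G σ v → SInf
  Fμ S m = ¬ InfPlay G S × Fν S m

-- Excluded middle gives every strategy a well-defined count #_S(t) ∈ ℕ^∞ for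
-- each outcome, so F^ν(S) consists of the single monomial of these counts, and
-- all four claims reduce to statements about the counts. The one combinatorial fact is that a strategy without finite
-- plays has an infinite one: a node of such a strategy always has a child, since
-- a childless node would end in a terminal position and so be a finite play.
module Submission where

open import Defs
open import Data.Nat using (ℕ; zero; suc; _≤_; _≤′_; ≤′-refl; ≤′-step)
open import Data.Nat.Properties using (≤-refl; ≤-antisym; ≮⇒≥; ≤⇒≤′)
open import Data.Bool using (true)
open import Data.Bool.Properties using () renaming (_≟_ to _≟ᵇ_)
open import Data.Fin.Properties using (any?)
open import Data.List using (List; []; _∷_)
open import Data.List.Relation.Unary.All using ([]; _∷_)
open import Data.List.Relation.Unary.AllPairs using ([]; _∷_)
open import Data.Product using (Σ; _×_; _,_; proj₁; proj₂)
open import Data.Sum using (_⊎_; inj₁; inj₂)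
open import Data.Empty using (⊥-elim)
open import Level using (0ℓ)
open import Axiom.ExcludedMiddle using (ExcludedMiddle)
open import Axiom.DoubleNegationElimination using (em⇒dne)
open import Relation.Nullary using (¬_; yes; no)
open import Relation.Binary.PropositionalEquality using (_≡_; refl; sym; cong; subst; subst₂)
open import Function.Bundles using (_⇔_; mk⇔; Equivalence)

≤∞-refl : ∀ c → c ≤∞ c
≤∞-refl (fin k) = fin≤fin ≤-refl
≤∞-refl ∞       = ∞ ≤∞∞

owner-cases : ∀ σ s → s ≡ σ ⊎ s ≡ opponent σ
owner-cases P0 P0 = inj₁ refl
owner-cases P0 P1 = inj₂ refl
owner-cases P1 P0 = inj₂ refl
owner-cases P1 P1 = inj₁ refl

module _ {n : ℕ} (G : Game n) where
  open Game G

  zeroMono : Mono G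
  zeroMono _ = fin 0

  module _ {σ : Player} {v : V G} (S : Strategy G σ v) where
    open Strategy S

    AtLeast-pred : ∀ t {k} → AtLeast G S t (suc k) → AtLeast G S t k
    AtLeast-pred t (_ ∷ qs , refl , _ ∷ unique , _ ∷ plays) = qs , refl , unique , plays

    AtLeast-≤′ : ∀ t {j k} → j ≤′ k → AtLeast G S t k → AtLeast G S t j
    AtLeast-≤′ t ≤′-refl        x = x
    AtLeast-≤′ t (≤′-step j≤′k) x = AtLeast-≤′ t j≤′k (AtLeast-pred t x)

    AtLeast-≤ : ∀ t {j k} → j ≤ k → AtLeast G S t k → AtLeast G S t j
    AtLeast-≤ t j≤k = AtLeast-≤′ t (≤⇒≤′ j≤k)

    AtLeast-zero : ∀ t → AtLeast G S t 0
    AtLeast-zero t = [] , refl , [] , []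

    PlayTo⇒AtLeast-one : ∀ t q → PlayTo G S t q → AtLeast G S t 1
    PlayTo⇒AtLeast-one t q play = q ∷ [] , refl , [] ∷ [] , play ∷ []

    AtLeast⇒≤ : ∀ t {j k} → AtLeast G S t j → ¬ AtLeast G S t (suc k) → j ≤ k
    AtLeast⇒≤ t x ¬y = ≮⇒≥ (λ k<j → ¬y (AtLeast-≤ t k<j x))

    Count-functional : ∀ t {c c′} → Count G S t c → Count G S t c′ → c ≡ c′
    Count-functional t {fin j} {fin k} (x , ¬x) (y , ¬y) =
      cong fin (≤-antisym (AtLeast⇒≤ t x ¬y) (AtLeast⇒≤ t y ¬x))
    Count-functional t {fin j} {∞} (_ , ¬x) all = ⊥-elim (¬x (all (suc j)))
    Count-functional t {∞} {fin k} all (_ , ¬y) = ⊥-elim (¬y (all (suc k)))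
    Count-functional t {∞} {∞} _ _ = refl

    Fν-zeroMono⇔OnlyInfinite : Fν G S zeroMono ⇔ OnlyInfinite G S
    Fν-zeroMono⇔OnlyInfinite = mk⇔
      (λ counts t q play → proj₂ (counts t) (PlayTo⇒AtLeast-one t q play))
      (λ onlyInf t → AtLeast-zero t , λ { (q ∷ [] , _ , _ , play ∷ []) → onlyInf t q play })

    ReachedNode : Set
    ReachedNode = Σ (V G) λ u → Σ (List (V G)) λ p → node (u ∷ p)

    -- Without finite plays no node of S ends in a terminal position, so it has
    -- an edge, and S keeps one (own move) or all (opponent's move) of them.
    child : OnlyInfinite G S → ∀ u p → node (u ∷ p) → Σ (V G) λ w → node (w ∷ u ∷ p)
    child onlyInf u p nd with kind u in owner
    ... | terminal = ⊥-elim (onlyInf (u , owner) p nd)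
    ... | owned s with owner-cases σ s
    ...   | inj₁ refl = let (w , nd′ , _) = oneSucc u p nd owner in w , nd′
    ...   | inj₂ refl with any? (λ w → E u w ≟ᵇ true)
    ...     | yes (w , edge) = w , allSucc u p nd owner w edge
    ...     | no noEdge =
              ⊥-elim (onlyInf (u , Equivalence.from (terminal⇔noMove u) λ w e → noEdge (w , e)) p nd)

    module _ (onlyInf : OnlyInfinite G S) where

      run : ℕ → ReachedNode
      run zero    = v , [] , hasRoot
      run (suc k) = let (u , p , nd) = run k ; (w , nd′) = child onlyInf u p nd in w , u ∷ p , nd′

      runPositions : ℕ → V G
      runPositions k = proj₁ (run k)

      prefixOf-runPositions : ∀ k → prefixOf G S runPositions k ≡ proj₁ (run k) ∷ proj₁ (proj₂ (run k))
      prefixOf-runPositions zero    = refl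
      prefixOf-runPositions (suc k) = cong (runPositions (suc k) ∷_) (prefixOf-runPositions k)

      OnlyInfinite⇒InfPlay : InfPlay G S
      OnlyInfinite⇒InfPlay =
        runPositions , λ k → subst node (sym (prefixOf-runPositions k)) (proj₂ (proj₂ (run k)))

    Fμ-zeroMono⇒⊥ : ¬ Fμ G S zeroMono
    Fμ-zeroMono⇒⊥ (¬inf , counts) =
      ¬inf (OnlyInfinite⇒InfPlay (Equivalence.to Fν-zeroMono⇔OnlyInfinite counts))

    module _ (em : ExcludedMiddle 0ℓ) where

      countBelow : ∀ t k → ¬ AtLeast G S t k → Σ ℕ∞ (Count G S t)
      countBelow t zero    ¬x = ⊥-elim (¬x (AtLeast-zero t))
      countBelow t (suc k) ¬x with em {AtLeast G S t k}
      ... | yes x  = fin k , x , ¬x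
      ... | no ¬x′ = countBelow t k ¬x′

      count : ∀ t → Σ ℕ∞ (Count G S t)
      count t with em {∀ k → AtLeast G S t k}
      ... | yes all  = ∞ , all
      ... | no ¬all = countBelow t (proj₁ bounded) (proj₂ bounded)
        where
        bounded : Σ ℕ λ k → ¬ AtLeast G S t k
        bounded = em⇒dne em λ unbounded → ¬all λ k → em⇒dne em λ ¬x → unbounded (k , ¬x)

      countMono : Mono G
      countMono t = proj₁ (count t)

      Fν-countMono : Fν G S countMono
      Fν-countMono t = proj₂ (count t)

module _ (em : ExcludedMiddle 0ℓ) {n : ℕ} (G : Game n) {σ : Player} {v : V G} where

  module _ (S : Strategy G σ v) where

    Fν≉0 : ¬ _≈S_ G (Fν G S) (0S G)
    Fν≉0 Fν≈0 = Equivalence.to (Fν≈0 (countMono G S em)) (Fν-countMono G S em)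

    Fμ⪯Fν : _⪯S_ G (Fμ G S) (Fν G S)
    Fμ⪯Fν m (_ , counts) = m , counts , λ t → ≤∞-refl (m t)

    Fμ≉1 : ¬ _≈S_ G (Fμ G S) (1S G)
    Fμ≉1 Fμ≈1 = Fμ-zeroMono⇒⊥ G S (Equivalence.from (Fμ≈1 (zeroMono G)) λ _ → refl)

    Fμ≈0⇔InfPlay : _≈S_ G (Fμ G S) (0S G) ⇔ InfPlay G S
    Fμ≈0⇔InfPlay = mk⇔ Fμ≈0⇒InfPlay λ inf _ → mk⇔ (λ x → proj₁ x inf) ⊥-elim
      where
      Fμ≈0⇒InfPlay : _≈S_ G (Fμ G S) (0S G) → InfPlay G S
      Fμ≈0⇒InfPlay Fμ≈0 with em {InfPlay G S}
      ... | yes inf  = inf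
      ... | no ¬inf = ⊥-elim (Equivalence.to (Fμ≈0 (countMono G S em)) (¬inf , Fν-countMono G S em))

    ¬InfPlay⇒Fμ≈Fν : ¬ InfPlay G S → _≈S_ G (Fμ G S) (Fν G S)
    ¬InfPlay⇒Fμ≈Fν ¬inf _ = mk⇔ proj₂ (¬inf ,_)

    Fν≈1⇔OnlyInfinite : _≈S_ G (Fν G S) (1S G) ⇔ OnlyInfinite G S
    Fν≈1⇔OnlyInfinite = mk⇔
      (λ Fν≈1 → Equivalence.to (Fν-zeroMono⇔OnlyInfinite G S) (Equivalence.from (Fν≈1 (zeroMono G)) λ _ → refl))
      (λ onlyInf m → let zeroCounts = Equivalence.from (Fν-zeroMono⇔OnlyInfinite G S) onlyInf in
        mk⇔ (λ counts t → Count-functional G S t (counts t) (zeroCounts t))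
            (λ m≡0 t → subst (Count G S t) (sym (m≡0 t)) (zeroCounts t)))

  module _ (S S′ : Strategy G σ v) where

    CountsBelow : Set
    CountsBelow = ∀ t c c′ → Count G S t c → Count G S′ t c′ → c ≤∞ c′

    CountsBelow⇔Fν-⪯ : CountsBelow ⇔ _⪯S_ G (Fν G S′) (Fν G S)
    CountsBelow⇔Fν-⪯ = mk⇔
      (λ below m′ counts′ → countMono G S em , Fν-countMono G S em ,
        λ t → below t _ _ (Fν-countMono G S em t) (counts′ t))
      λ Fν⪯ t c c′ count count′ →
        let (m , counts , m⪯) = Fν⪯ (countMono G S′ em) (Fν-countMono G S′ em)
        in subst₂ _≤∞_ (Count-functional G S t (counts t) count)
                        (Count-functional G S′ t (Fν-countMono G S′ em t) count′) (m⪯ t)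

    Fμ-⪯⇒InfPlay-preserved : _⪯S_ G (Fμ G S′) (Fμ G S) → InfPlay G S → InfPlay G S′
    Fμ-⪯⇒InfPlay-preserved Fμ⪯ inf with em {InfPlay G S′}
    ... | yes inf′  = inf′
    ... | no ¬inf′ = ⊥-elim (proj₁ (proj₁ (proj₂ (Fμ⪯ (countMono G S′ em) (¬inf′ , Fν-countMono G S′ em)))) inf)

    Absorbs⇒Fμ-⪯ : Absorbs G S S′ → _⪯S_ G (Fμ G S′) (Fμ G S)
    Absorbs⇒Fμ-⪯ (below , preserved) m′ (¬inf′ , counts′) =
      countMono G S em , ((λ inf → ¬inf′ (preserved inf)) , Fν-countMono G S em) ,
      λ t → below t _ _ (Fν-countMono G S em t) (counts′ t)

    Absorbs⇔Fν-⪯×Fμ-⪯ : Absorbs G S S′ ⇔ (_⪯S_ G (Fν G S′) (Fν G S) × _⪯S_ G (Fμ G S′) (Fμ G S))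
    Absorbs⇔Fν-⪯×Fμ-⪯ = mk⇔
      (λ absorbs → Equivalence.to CountsBelow⇔Fν-⪯ (proj₁ absorbs) , Absorbs⇒Fμ-⪯ absorbs)
      (λ (Fν⪯ , Fμ⪯) → Equivalence.from CountsBelow⇔Fν-⪯ Fν⪯ , Fμ-⪯⇒InfPlay-preserved Fμ⪯)

mainTheorem13 : ExcludedMiddle 0ℓ →
    ∀ {n : ℕ} (G : Game n) (σ : Player) (v : V G) (S S′ : Strategy G σ v) →
      (¬ (_≈S_ G (Fν G S) (0S G)) × _⪯S_ G (Fμ G S) (Fν G S) × ¬ (_≈S_ G (Fμ G S) (1S G)))
      × ((_≈S_ G (Fμ G S) (0S G) ⇔ InfPlay G S) × (¬ InfPlay G S → _≈S_ G (Fμ G S) (Fν G S)))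
      × (_≈S_ G (Fν G S) (1S G) ⇔ OnlyInfinite G S)
      × (Absorbs G S S′ ⇔ (_⪯S_ G (Fν G S′) (Fν G S) × _⪯S_ G (Fμ G S′) (Fμ G S)))
mainTheorem13 em G σ v S S′ =
  (Fν≉0 em G S , Fμ⪯Fν em G S , Fμ≉1 em G S) ,
  (Fμ≈0⇔InfPlay em G S , ¬InfPlay⇒Fμ≈Fν em G S) ,
  Fν≈1⇔OnlyInfinite em G S ,
  Absorbs⇔Fν-⪯×Fμ-⪯ em G S S′
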